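{- If $G$ is an embedded graph that is orientable (embedded in an orientable surface) and checkerboard colourable (faces can be 2-coloured so that faces sharing an edge get different colours), then $P(G;-1)=(-1)^{f(G)}2^{e(G)}$, where $f(G)$ and $e(G)$ are the numbers of faces and edges of $G$.
   Context: The medial graph $G_m$ of $G$ has a degree-4 vertex $v_e$ on each edge $e$ of $G$, with edges following face boundaries of $G$ (an isolated vertex contributes a vertex-free closed curve); faces of $G_m$ containing a vertex of $G$ are black, others white. At $v_e$: the white split pairs consecutive half-edges bounding white corners, the black split those bounding black corners, the crossing pairs opposite half-edges. A state $s$ chooses a vertex state at each vertex; $c(s)$ = number of resulting closed curves, $cr(s)$ = number of crossings; Penrose states have no black split; $P(G;\lambda)=\sum_{s\text{ Penrose}}(-1)^{cr(s)}\lambda^{c(s)}$. -}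

module Defs where

open import Data.Nat using (ℕ; zero; suc; _+_; _*_)
open import Data.Fin using (Fin; zero; suc)
import Data.Fin as Fin
open import Data.Bool using (Bool; true; false; not; _∨_; if_then_else_)
import Data.Bool as Bool
open import Data.Product using (_×_; _,_; Σ; ∃)
open import Data.Product.Properties using (≡-dec)
open import Data.List using (List; []; _∷_; map; concatMap; allFin)
open import Data.Bool.ListAction using (any)
open import Data.Integer using (ℤ; -1ℤ) renaming (_+_ to _+ℤ_; _*_ to _*ℤ_; _^_ to _^ℤ_)
open import Relation.Nullary.Decidable using (⌊_⌋; Dec)
open import Relation.Binary.PropositionalEquality using (_≡_; _≢_)

-- Embedded graphs as (closed) generalized maps ("gems"), with edges
-- labelled explicitly.
--
-- A flag of G is an (edge, end, side) triple: for edge i, the boolean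
-- 'end' says at which of the two ends (vertex-incidences) of i we are
-- and 'side' on which of the two sides (face-incidences) of i we are.
-- The three gem involutions are
--   τ₀ : change the end   (same edge, same side)
--   τ₂ : change the side  (same edge, same end)
--   τ₁ : move to the next edge around the corner (same vertex, same face)
-- τ₀ and τ₂ are fixed by the encoding; τ₁ is the data of the embedding.
-- Vertices carrying edges = ⟨τ₁,τ₂⟩-orbits, edges = ⟨τ₀,τ₂⟩-orbits,
-- faces = ⟨τ₀,τ₁⟩-orbits, corners = τ₁-pairs.  Isolated vertices are
-- recorded separately (each is also a face and, in the medial graph,
-- a vertex-free closed curve).

Flag : ℕ → Set
Flag e = Fin e × Bool × Bool

τ₀ : ∀ {e} → Flag e → Flag e
τ₀ (i , a , b) = (i , not a , b)

τ₂ : ∀ {e} → Flag e → Flag e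
τ₂ (i , a , b) = (i , a , not b)

record EmbeddedGraph : Set where
  field
    nEdges    : ℕ
    nIsolated : ℕ
    τ₁        : Flag nEdges → Flag nEdges
    τ₁-invol  : ∀ x → τ₁ (τ₁ x) ≡ x
    τ₁-fpf    : ∀ x → τ₁ x ≢ x

open EmbeddedGraph public

_≟F_ : ∀ {e} (x y : Flag e) → Dec (x ≡ y)
_≟F_ = ≡-dec Fin._≟_ (≡-dec Bool._≟_ Bool._≟_)

allFlags : (e : ℕ) → List (Flag e)
allFlags e = concatMap (λ i → map (λ ab → (i , ab))
               ((false , false) ∷ (false , true) ∷ (true , false) ∷ (true , true) ∷ []))
             (allFin e)

reachIn : ∀ {e} → ℕ → List (Flag e → Flag e) → Flag e → Flag e → Bool
reachIn zero    gs x y = ⌊ x ≟F y ⌋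
reachIn (suc k) gs x y = ⌊ x ≟F y ⌋ ∨ any (λ g → reachIn k gs (g x) y) gs

-- reachability (paths of length < number of flags suffice)
reach : ∀ {e} → List (Flag e → Flag e) → Flag e → Flag e → Bool
reach {e} gs = reachIn (4 * e) gs

countReps : ∀ {e} → List (Flag e → Flag e) → List (Flag e) → List (Flag e) → ℕ
countReps gs seen []       = 0
countReps gs seen (x ∷ xs) =
  if any (reach gs x) seen
  then countReps gs (x ∷ seen) xs
  else suc (countReps gs (x ∷ seen) xs)

orbits : ∀ {e} → List (Flag e → Flag e) → ℕ
orbits {e} gs = countReps gs [] (allFlags e)

e[_] : EmbeddedGraph → ℕ
e[ G ] = nEdges G

f[_] : EmbeddedGraph → ℕ
f[ G ] = orbits (τ₀ ∷ τ₁ G ∷ []) + nIsolated G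

-- Orientability: the flag graph (edges τ₀, τ₁, τ₂) is bipartite.

Orientable : EmbeddedGraph → Set
Orientable G = Σ (Flag (nEdges G) → Bool) λ o →
  ∀ x → (o (τ₀ x) ≢ o x) × (o (τ₁ G x) ≢ o x) × (o (τ₂ x) ≢ o x)

-- Checkerboard colourable: a colouring of faces (constant on
-- ⟨τ₀,τ₁⟩-orbits) such that the two sides of every edge differ.
-- (Isolated vertices' faces share no edge and can be coloured freely.)
CheckerboardColourable : EmbeddedGraph → Set
CheckerboardColourable G = Σ (Flag (nEdges G) → Bool) λ c →
  ∀ x → (c (τ₀ x) ≡ c x) × (c (τ₁ G x) ≡ c x) × (c (τ₂ x) ≢ c x)

-- The medial vertex v_i on edge i has four half-edges, one per flag of
-- i (the half-edge heading to the corner {x, τ₁ x}); medial edges are the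
-- corners {x, τ₁ x}.  At v_i:
--   white split pairs x with τ₀ x   (the two half-edges bounding a face of G),
--   black split pairs x with τ₂ x   (bounding a vertex of G),
--   crossing    pairs x with τ₀(τ₂ x) (opposite half-edges).
-- A Penrose state chooses, at every edge, white split (false) or
-- crossing (true).

PenroseState : ℕ → Set
PenroseState e = Fin e → Bool

pairing : ∀ {e} → PenroseState e → Flag e → Flag e
pairing s (i , a , b) = if s i then (i , not a , not b) else (i , not a , b)

curves : (G : EmbeddedGraph) → PenroseState (nEdges G) → ℕ
curves G s = orbits (τ₁ G ∷ pairing s ∷ []) + nIsolated G

countTrue : (e : ℕ) → PenroseState e → ℕ
countTrue zero    s = 0
countTrue (suc e) s = (if s zero then 1 else 0) + countTrue e (λ i → s (suc i))

cr : ∀ {e} → PenroseState e → ℕ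
cr {e} s = countTrue e s

sumStates : (e : ℕ) → (PenroseState e → ℤ) → ℤ
sumStates zero    f = f (λ ())
sumStates (suc e) f =
  sumStates e (λ s → f (λ { zero → false ; (suc i) → s i }))
  +ℤ sumStates e (λ s → f (λ { zero → true ; (suc i) → s i }))

P : EmbeddedGraph → ℤ → ℤ
P G λ′ = sumStates (nEdges G) (λ s → (-1ℤ ^ℤ cr s) *ℤ (λ′ ^ℤ curves G s))

module Submission where

-- An orientation o and a checkerboard colouring c combine into the flag colouring o xor c,
-- which τ₀ and τ₁ flip and τ₂ keeps; so it alternates along the closed curves of every
-- Penrose state.  Cutting the curves of a state at one edge leaves, through that edge,
-- two paths whose four ends are the flags of the edge, and the colouring forces each path
-- to join an end (i , false , _) to an end (i , true , _).  Of the white split and the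
-- crossing, one reconnects the two paths into two curves and the other into one, so
-- switching one edge changes cr(s) by one and c(s) by ±1.  Hence (-1)^(cr(s) + c(s)) is the
-- same for all Penrose states; at the all-white-split state the curves are the face
-- boundaries, which gives (-1)^f(G) for each of the 2^e(G) terms of P(G; -1).

open import Defs
open import Data.Nat using () renaming (_^_ to _^ℕ_)
open import Data.Integer using (ℤ; +_; -1ℤ; _*_; _^_)
open import Relation.Binary.PropositionalEquality using (_≡_)

open import Level using (0ℓ)
open import Data.Nat as ℕ using (ℕ; zero; suc; _+_; _≤_; _<_; z≤n; s≤s)
import Data.Nat.Properties as ℕₚ
import Data.Integer as ℤ
import Data.Integer.Properties as ℤₚ
import Data.Vec.Functional as Vector
open import Data.Fin as Fin using (Fin; zero; suc)
open import Data.Fin.Properties using (suc-injective)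
open import Data.Bool using (Bool; true; false; T; not; _∨_; _∧_; _xor_; if_then_else_)
open import Data.Bool.Properties using (T-≡; T-∨; T-∧; ∨-zeroʳ; ∧-identityʳ; not-involutive; ¬-not; not-¬; not-distribˡ-xor; xor-annihilates-not)
open import Data.Bool.ListAction using (any; or)
open import Data.Unit using (tt)
open import Data.Sum using (_⊎_; inj₁; inj₂)
open import Data.Empty using (⊥-elim)
open import Data.Product using (Σ; ∃; _×_; _,_; proj₁; proj₂)
open import Data.List using (List; []; _∷_; length; _++_; map; concatMap; allFin; applyDownFrom)
open import Data.List.Properties using (map-cong; length-++-sucʳ; length-tabulate; length-applyDownFrom)
open import Data.List.Relation.Unary.All using (All; []; _∷_)
import Data.List.Relation.Unary.All as All
open import Data.List.Relation.Unary.All.Properties using (¬Any⇒All¬)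
open import Data.List.Relation.Unary.Any using (Any; here; there)
import Data.List.Relation.Unary.Any as Any
open import Data.List.Relation.Unary.Any.Properties using (any⁺; any⁻)
open import Data.List.Relation.Unary.Unique.Propositional using (Unique; []; _∷_)
open import Data.List.Membership.Propositional using (_∈_; _∉_; find)
open import Data.List.Membership.Propositional.Properties using (∈-∃++; ∈-++⁻; ∈-++⁺ˡ; ∈-++⁺ʳ; ∈-allFin; ∈-concatMap⁺; ∈-applyDownFrom⁻)
import Data.List.Membership.DecPropositional as DecMembership
open import Function using (_∘_; Equivalence)
open import Relation.Binary using (Rel; IsEquivalence; _⇒_; DecidableEquality)
open import Relation.Binary.Construct.Closure.ReflexiveTransitive using (Star; ε; _◅_; _◅◅_; reverse; fold; _⋆)
open import Relation.Binary.PropositionalEquality using (_≢_; refl; sym; trans; cong; cong₂; subst; module ≡-Reasoning)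
open import Relation.Nullary using (¬_; yes; no)
open import Relation.Nullary.Decidable using (⌊_⌋; toWitness; fromWitness; T?)

-- Merging two classes of a boolean equivalence

Holds : {A : Set} → (A → A → Bool) → A → A → Set
Holds r x y = T (r x y)

T-injective : ∀ {a b} → (T a → T b) → (T b → T a) → a ≡ b
T-injective {false} {false} _ _ = refl
T-injective {false} {true}  _ g = ⊥-elim (g tt)
T-injective {true}  {false} f _ = ⊥-elim (f tt)
T-injective {true}  {true}  _ _ = refl

T-∨-intro : ∀ a b → T a ⊎ T b → T (a ∨ b)
T-∨-intro a b = Equivalence.from (T-∨ {a} {b})

any-cong : ∀ {A : Set} {p q : A → Bool} → (∀ x → p x ≡ q x) → ∀ xs → any p xs ≡ any q xs
any-cong p≗q xs = cong or (map-cong p≗q xs)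

any-∨ : ∀ {A : Set} (p q : A → Bool) xs → any (λ x → p x ∨ q x) xs ≡ any p xs ∨ any q xs
any-∨ p q []       = refl
any-∨ p q (x ∷ xs) rewrite any-∨ p q xs = ∨-interchange (p x) (q x) _ _
  where
  ∨-interchange : ∀ a b c d → (a ∨ b) ∨ (c ∨ d) ≡ (a ∨ c) ∨ (b ∨ d)
  ∨-interchange true  b c     d = refl
  ∨-interchange false b true  d = ∨-zeroʳ b
  ∨-interchange false b false d = refl

module _ {A : Set} where

  merge : (A → A → Bool) → A → A → A → A → Bool
  merge r u v x y = r x y ∨ r x u ∧ r v y ∨ r x v ∧ r u y

  data MergeView (r : A → A → Bool) (u v x y : A) : Set where
    unmerged : Holds r x y → MergeView r u v x y
    via-uv   : Holds r x u → Holds r v y → MergeView r u v x y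
    via-vu   : Holds r x v → Holds r u y → MergeView r u v x y

  ⊆-merge : ∀ r u v → Holds r ⇒ Holds (merge r u v)
  ⊆-merge r u v {x} {y} = T-∨-intro (r x y) _ ∘ inj₁

  module _ {r : A → A → Bool} {u v : A} where

    merge-view : ∀ {x y} → Holds (merge r u v) x y → MergeView r u v x y
    merge-view {x} {y} h with Equivalence.to (T-∨ {r x y}) h
    ... | inj₁ rxy = unmerged rxy
    ... | inj₂ h′ with Equivalence.to (T-∨ {r x u ∧ r v y}) h′
    ...   | inj₁ h″ = let xu , vy = Equivalence.to (T-∧ {r x u}) h″ in via-uv xu vy
    ...   | inj₂ h″ = let xv , uy = Equivalence.to (T-∧ {r x v}) h″ in via-vu xv uy

    merge-intro : ∀ {x y} → MergeView r u v x y → Holds (merge r u v) x y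
    merge-intro {x} {y} (unmerged rxy) = T-∨-intro (r x y) _ (inj₁ rxy)
    merge-intro {x} {y} (via-uv xu vy) =
      T-∨-intro (r x y) _ (inj₂ (T-∨-intro (r x u ∧ r v y) _ (inj₁ (Equivalence.from T-∧ (xu , vy)))))
    merge-intro {x} {y} (via-vu xv uy) =
      T-∨-intro (r x y) _ (inj₂ (T-∨-intro (r x u ∧ r v y) _ (inj₂ (Equivalence.from T-∧ (xv , uy)))))

    merge-least : ∀ {R} → IsEquivalence (Holds R) → Holds r ⇒ Holds R → Holds R u v →
                  Holds (merge r u v) ⇒ Holds R
    merge-least {R} R-equiv r⇒R Ruv = from-view ∘ merge-view
      where
      open IsEquivalence R-equiv renaming (trans to R-trans; sym to R-sym)
      from-view : ∀ {x y} → MergeView r u v x y → Holds R x y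
      from-view (unmerged xy)  = r⇒R xy
      from-view (via-uv xu vy) = R-trans (r⇒R xu) (R-trans Ruv (r⇒R vy))
      from-view (via-vu xv uy) = R-trans (r⇒R xv) (R-trans (R-sym Ruv) (r⇒R uy))

    merge-absorbs : IsEquivalence (Holds r) → Holds r u v → Holds (merge r u v) ⇒ Holds r
    merge-absorbs r-equiv uv = merge-least r-equiv (λ xy → xy) uv

  module _ {r : A → A → Bool} (r-equiv : IsEquivalence (Holds r)) where
    open IsEquivalence r-equiv renaming (refl to r-refl; sym to r-sym; trans to r-trans)

    merge-relates : ∀ u v → Holds (merge r u v) u v
    merge-relates u v = merge-intro {r = r} (via-uv r-refl r-refl)

    merge-isEquivalence : ∀ u v → IsEquivalence (Holds (merge r u v))
    merge-isEquivalence u v = record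
      { refl  = merge-intro {r = r} (unmerged r-refl)
      ; sym   = λ h → merge-intro (view-sym (merge-view {r = r} h))
      ; trans = λ h h′ → merge-intro (compose (merge-view {r = r} h) (merge-view h′))
      }
      where
      view-sym : ∀ {x y} → MergeView r u v x y → MergeView r u v y x
      view-sym (unmerged xy)  = unmerged (r-sym xy)
      view-sym (via-uv xu vy) = via-vu (r-sym vy) (r-sym xu)
      view-sym (via-vu xv uy) = via-uv (r-sym uy) (r-sym xv)

      compose : ∀ {x y z} → MergeView r u v x y → MergeView r u v y z → MergeView r u v x z
      compose (unmerged xy)  (unmerged yz)  = unmerged (r-trans xy yz)
      compose (unmerged xy)  (via-uv yu vz) = via-uv (r-trans xy yu) vz
      compose (unmerged xy)  (via-vu yv uz) = via-vu (r-trans xy yv) uz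
      compose (via-uv xu vy) (unmerged yz)  = via-uv xu (r-trans vy yz)
      compose (via-uv xu vy) (via-uv yu vz) = unmerged (r-trans xu (r-trans (r-sym (r-trans vy yu)) vz))
      compose (via-uv xu vy) (via-vu yv uz) = unmerged (r-trans xu uz)
      compose (via-vu xv uy) (unmerged yz)  = via-vu xv (r-trans uy yz)
      compose (via-vu xv uy) (via-uv yu vz) = unmerged (r-trans xv vz)
      compose (via-vu xv uy) (via-vu yv uz) = unmerged (r-trans xv (r-trans (r-sym (r-trans uy yv)) uz))

    class-≡ : ∀ {x y} → Holds r x y → ∀ z → r x z ≡ r y z
    class-≡ xy z = T-injective (r-trans (r-sym xy)) (r-trans xy)

  -- For an equivalence r, countFresh r [] L is the number of classes meeting L;
  -- countReps gs is the case r = reach gs.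
  countFresh : (A → A → Bool) → List A → List A → ℕ
  countFresh r seen []       = 0
  countFresh r seen (x ∷ xs) =
    if any (r x) seen then countFresh r (x ∷ seen) xs else suc (countFresh r (x ∷ seen) xs)

  countFresh-cong : ∀ {r r′} → Holds r ⇒ Holds r′ → Holds r′ ⇒ Holds r →
                    ∀ seen xs → countFresh r seen xs ≡ countFresh r′ seen xs
  countFresh-cong r⇒r′ r′⇒r seen []       = refl
  countFresh-cong r⇒r′ r′⇒r seen (x ∷ xs) =
    cong₂ (λ b n → if b then n else suc n)
          (any-cong (λ y → T-injective (r⇒r′ {x} {y}) r′⇒r) seen)
          (countFresh-cong r⇒r′ r′⇒r (x ∷ seen) xs)

  indicator : Bool → ℕ
  indicator true  = 1
  indicator false = 0

  module _ {r : A → A → Bool} (r-equiv : IsEquivalence (Holds r)) {u v : A} (u≁v : ¬ Holds r u v) where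
    open IsEquivalence r-equiv renaming (refl to r-refl; sym to r-sym; trans to r-trans)

    private
      r′ : A → A → Bool
      r′ = merge r u v

      merged-class : ∀ {x} → Holds r u x ⊎ Holds r v x → ∀ z → r′ x z ≡ r u z ∨ r v z
      merged-class {x} x∈uv z = T-injective (to x∈uv) (from x∈uv)
        where
        to : Holds r u x ⊎ Holds r v x → Holds r′ x z → T (r u z ∨ r v z)
        to x∈uv h with merge-view {r = r} h | x∈uv
        ... | unmerged xz | inj₁ ux = T-∨-intro (r u z) _ (inj₁ (r-trans ux xz))
        ... | unmerged xz | inj₂ vx = T-∨-intro (r u z) _ (inj₂ (r-trans vx xz))
        ... | via-uv _ vz | _       = T-∨-intro (r u z) _ (inj₂ vz)
        ... | via-vu _ uz | _       = T-∨-intro (r u z) _ (inj₁ uz)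
        from : Holds r u x ⊎ Holds r v x → T (r u z ∨ r v z) → Holds r′ x z
        from x∈uv h with Equivalence.to (T-∨ {r u z}) h | x∈uv
        ... | inj₁ uz | inj₁ ux = merge-intro {r = r} (unmerged (r-trans (r-sym ux) uz))
        ... | inj₁ uz | inj₂ vx = merge-intro {r = r} (via-vu (r-sym vx) uz)
        ... | inj₂ vz | inj₁ ux = merge-intro {r = r} (via-uv (r-sym ux) vz)
        ... | inj₂ vz | inj₂ vx = merge-intro {r = r} (unmerged (r-trans (r-sym vx) vz))

      unmerged-class : ∀ {x} → ¬ Holds r u x → ¬ Holds r v x → ∀ z → r′ x z ≡ r x z
      unmerged-class {x} u≁x v≁x z = T-injective to (λ xz → merge-intro {r = r} (unmerged xz))
        where
        to : Holds r′ x z → Holds r x z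
        to h with merge-view {r = r} h
        ... | unmerged xz = xz
        ... | via-uv xu _ = ⊥-elim (u≁x (r-sym xu))
        ... | via-vu xv _ = ⊥-elim (v≁x (r-sym xv))

      step-merged-u : ∀ a b {C C′ k} → indicator b + C ≡ k + C′ →
                      indicator (a ∧ b) + (if a then C else suc C) ≡ k + (if a ∨ b then C′ else suc C′)
      step-merged-u true  b     ih = ih
      step-merged-u false true  ih = ih
      step-merged-u false false {k = k} ih = trans (cong suc ih) (sym (ℕₚ.+-suc k _))

      step-merged-v : ∀ a b {C C′ k} → indicator a + C ≡ k + C′ →
                      indicator (a ∧ b) + (if b then C else suc C) ≡ k + (if a ∨ b then C′ else suc C′)
      step-merged-v true  true  ih = ih
      step-merged-v false true  ih = ih
      step-merged-v true  false ih = ih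
      step-merged-v false false {k = k} ih = trans (cong suc ih) (sym (ℕₚ.+-suc k _))

      step-unmerged : ∀ c {J C C′ k} → J + C ≡ k + C′ →
                      J + (if c then C else suc C) ≡ k + (if c then C′ else suc C′)
      step-unmerged true  ih = ih
      step-unmerged false {J} {C} {k = k} ih = trans (ℕₚ.+-suc J C) (trans (cong suc ih) (sym (ℕₚ.+-suc k _)))

    -- The two counts differ by one from the moment both the u-class and the v-class have been seen.
    countFresh-merge-invariant : ∀ seen xs →
      indicator (any (r u) seen ∧ any (r v) seen) + countFresh r seen xs ≡
      indicator ((any (r u) xs ∨ any (r u) seen) ∧ (any (r v) xs ∨ any (r v) seen)) + countFresh (merge r u v) seen xs
    countFresh-merge-invariant seen [] = refl
    countFresh-merge-invariant seen (x ∷ xs)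
      with r u x in ux | r v x in vx | countFresh-merge-invariant (x ∷ seen) xs
    ... | true  | true  | _  = ⊥-elim (u≁v (r-trans (Equivalence.from T-≡ ux) (r-sym (Equivalence.from T-≡ vx))))
    ... | true  | false | ih
      rewrite any-cong (class-≡ r-equiv (r-sym (Equivalence.from T-≡ ux))) seen
            | any-cong (merged-class (inj₁ (Equivalence.from T-≡ ux))) seen
            | any-∨ (r u) (r v) seen
            | ∨-zeroʳ (any (r u) xs)
      = step-merged-u (any (r u) seen) (any (r v) seen) ih
    ... | false | true  | ih
      rewrite any-cong (class-≡ r-equiv (r-sym (Equivalence.from T-≡ vx))) seen
            | any-cong (merged-class (inj₂ (Equivalence.from T-≡ vx))) seen
            | any-∨ (r u) (r v) seen
            | ∨-zeroʳ (any (r v) xs)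
            | ∧-identityʳ (any (r u) seen)
      = step-merged-v (any (r u) seen) (any (r v) seen) ih
    ... | false | false | ih
      rewrite any-cong (unmerged-class (subst T ux) (subst T vx)) seen
      = step-unmerged (any (r x) seen) ih

    countFresh-merge : ∀ {L} → u ∈ L → v ∈ L → countFresh r [] L ≡ suc (countFresh (merge r u v) [] L)
    countFresh-merge {L} u∈L v∈L
      with any (r u) L in u-seen | any (r v) L in v-seen | countFresh-merge-invariant [] L
    ... | true  | true  | invariant = invariant
    ... | false | _     | _ = ⊥-elim (subst T u-seen (any⁺ (r u) (Any.map (λ { refl → r-refl }) u∈L)))
    ... | true  | false | _ = ⊥-elim (subst T v-seen (any⁺ (r v) (Any.map (λ { refl → r-refl }) v∈L)))

  module _ {r : A → A → Bool} (r-equiv : IsEquivalence (Holds r)) where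
    open IsEquivalence r-equiv renaming (refl to r-refl; sym to r-sym; trans to r-trans)

    -- Joining two paths p⋯a and q⋯b at their ends: p–a, q–b closes two cycles, p–b, q–a closes one.
    countFresh-reconnect : ∀ {p q a b L} → ¬ Holds r p q → Holds r p a → Holds r q b → p ∈ L → b ∈ L →
      countFresh (merge (merge r p a) q b) [] L ≡ suc (countFresh (merge (merge r p b) q a) [] L)
    countFresh-reconnect {p} {q} {a} {b} {L} p≁q pa qb p∈L b∈L = begin
      countFresh (merge (merge r p a) q b) [] L       ≡⟨ countFresh-cong same⇒r r⇒same [] L ⟩
      countFresh r [] L                               ≡⟨ countFresh-merge r-equiv p≁b p∈L b∈L ⟩
      suc (countFresh (merge r p b) [] L)             ≡⟨ cong suc (countFresh-cong (⊆-merge (merge r p b) q a) cross⇒pb [] L) ⟩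
      suc (countFresh (merge (merge r p b) q a) [] L) ∎
      where
      open ≡-Reasoning
      module PB = IsEquivalence (merge-isEquivalence r-equiv p b)
      same⇒r : Holds (merge (merge r p a) q b) ⇒ Holds r
      same⇒r = merge-least r-equiv (merge-absorbs r-equiv pa) qb
      r⇒same : Holds r ⇒ Holds (merge (merge r p a) q b)
      r⇒same = ⊆-merge (merge r p a) q b ∘ ⊆-merge r p a
      p≁b : ¬ Holds r p b
      p≁b pb = p≁q (r-trans pb (r-sym qb))
      cross⇒pb : Holds (merge (merge r p b) q a) ⇒ Holds (merge r p b)
      cross⇒pb = merge-absorbs (merge-isEquivalence r-equiv p b)
        (PB.trans (⊆-merge r p b qb) (PB.trans (PB.sym (merge-relates r-equiv p b)) (⊆-merge r p b pa)))

-- Reachability and paths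

module _ {A : Set} where

  Unique-length-≤ : ∀ {xs ys : List A} → Unique xs → (∀ {z} → z ∈ xs → z ∈ ys) → length xs ≤ length ys
  Unique-length-≤ [] _ = z≤n
  Unique-length-≤ {x ∷ xs} (x≢xs ∷ u) xs⊆ys with ∈-∃++ (xs⊆ys (here refl))
  ... | ys₁ , ys₂ , refl =
    subst (suc (length xs) ≤_) (sym (length-++-sucʳ ys₁ x ys₂)) (s≤s (Unique-length-≤ u remove-x))
    where
    remove-x : ∀ {z} → z ∈ xs → z ∈ ys₁ ++ ys₂
    remove-x {z} z∈xs with ∈-++⁻ ys₁ (xs⊆ys (there z∈xs))
    ... | inj₁ z∈ys₁         = ∈-++⁺ˡ z∈ys₁
    ... | inj₂ (here refl)   = ⊥-elim (All.lookup x≢xs z∈xs refl)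
    ... | inj₂ (there z∈ys₂) = ∈-++⁺ʳ ys₁ z∈ys₂

  Step : List (A → A) → Rel A 0ℓ
  Step gs x y = Any (λ g → g x ≡ y) gs

  Reach : List (A → A) → Rel A 0ℓ
  Reach gs = Star (Step gs)

  step-∈ : ∀ {g gs} → g ∈ gs → ∀ x → Step gs x (g x)
  step-∈ g∈gs x = Any.map (λ g≡h → cong (λ h → h x) (sym g≡h)) g∈gs

  Involutions : List (A → A) → Set
  Involutions = All (λ g → ∀ x → g (g x) ≡ x)

  step-sym : ∀ {gs} → Involutions gs → ∀ {x y} → Step gs x y → Step gs y x
  step-sym (g-invol ∷ _) {x} (here refl) = here (g-invol x)
  step-sym (_ ∷ invols)      (there s)   = there (step-sym invols s)

  reach-sym : ∀ {gs} → Involutions gs → ∀ {x y} → Reach gs x y → Reach gs y x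
  reach-sym invols = reverse (step-sym invols)

  applyDownFrom-unique : ∀ (f : ℕ → A) n → (∀ {i j} → i < j → j < n → f i ≢ f j) → Unique (applyDownFrom f n)
  applyDownFrom-unique f zero    _     = []
  applyDownFrom-unique f (suc n) f-inj =
    ¬Any⇒All¬ _ fresh ∷ applyDownFrom-unique f n (λ i<j j<n → f-inj i<j (ℕₚ.m<n⇒m<1+n j<n))
    where
    fresh : f n ∉ applyDownFrom f n
    fresh fn∈ with ∈-applyDownFrom⁻ f fn∈
    ... | i , i<n , fn≡fi = f-inj i<n (ℕₚ.n<1+n n) (sym fn≡fi)

module _ {A : Set} {R : Rel A 0ℓ} where

  vertices : ∀ {x y} → Star R x y → List A
  vertices {x} ε       = x ∷ []
  vertices {x} (_ ◅ w) = x ∷ vertices w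

  private
    suffix : ∀ {a x y} (w : Star R a y) → Unique (vertices w) → x ∈ vertices w →
             Σ (Star R x y) (Unique ∘ vertices)
    suffix ε       u       (here refl) = ε , u
    suffix (s ◅ w) u       (here refl) = s ◅ w , u
    suffix (_ ◅ w) (_ ∷ u) (there x∈w) = suffix w u x∈w

  erase-loops : DecidableEquality A → ∀ {x y} → Star R x y → Σ (Star R x y) (Unique ∘ vertices)
  erase-loops _≟_ ε = ε , [] ∷ []
  erase-loops _≟_ {x} (s ◅ w) with erase-loops _≟_ w
  ... | w′ , w′-unique with DecMembership._∈?_ _≟_ x (vertices w′)
  ...   | yes x∈w′ = suffix w′ w′-unique x∈w′
  ...   | no  x∉w′ = s ◅ w′ , ¬Any⇒All¬ _ x∉w′ ∷ w′-unique

-- The α/β-component of a dead end z is the path z, α z, β (α z), … that stops at the first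
-- dead end after z, and the colour alternates along it.
module DeadEndPath
  {A : Set} (L : List A) (∈L : ∀ x → x ∈ L)
  (α β : A → A) (α-invol : ∀ x → α (α x) ≡ x) (β-invol : ∀ x → β (β x) ≡ x)
  (dead : A → Bool)
  (β-dead : ∀ {x} → T (dead x) → β x ≡ x)
  (β-live : ∀ {x} → ¬ T (dead x) → ¬ T (dead (β x)))
  (colour : A → Bool)
  (colour-α : ∀ x → colour (α x) ≡ not (colour x))
  (colour-β : ∀ {x} → ¬ T (dead x) → colour (β x) ≡ not (colour x))
  (z : A) (z-dead : T (dead z))
  where

  walk : ℕ → A
  walk zero    = z
  walk (suc j) = β (α (walk j))

  LiveUpTo : ℕ → Set
  LiveUpTo k = ∀ {m} → m < k → ¬ T (dead (α (walk m)))

  private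
    injective : ∀ {f : A → A} → (∀ x → f (f x) ≡ x) → ∀ {x y} → f x ≡ f y → x ≡ y
    injective {f} f-invol {x} {y} fx≡fy = trans (sym (f-invol x)) (trans (cong f fx≡fy) (f-invol y))

    walk-live : ∀ {k} → LiveUpTo k → ∀ {j} → j < k → ¬ T (dead (walk (suc j)))
    walk-live live j<k = β-live (live j<k)

    walk-injective : ∀ {k} → LiveUpTo k → ∀ {a b} → a < b → b ≤ k → walk a ≢ walk b
    walk-injective live {zero}  {suc b} _          b<k z≡walk = walk-live live b<k (subst (T ∘ dead) z≡walk z-dead)
    walk-injective live {suc a} {suc b} (s≤s a<b) b<k eq =
      walk-injective live a<b (ℕₚ.<⇒≤ b<k) (injective {α} α-invol (injective {β} β-invol eq))

    live-bounded : ∀ {k} → LiveUpTo k → k < length L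
    live-bounded {k} live = subst (_≤ length L) (length-applyDownFrom walk (suc k))
      (Unique-length-≤ (applyDownFrom-unique walk (suc k) (λ i<j j≤k → walk-injective live i<j (ℕₚ.≤-pred j≤k)))
                       (λ {x} _ → ∈L x))

    extend : ∀ {k} → LiveUpTo k → ¬ T (dead (α (walk k))) → LiveUpTo (suc k)
    extend live ¬dead (s≤s m≤k) with ℕₚ.m≤n⇒m<n∨m≡n m≤k
    ... | inj₁ m<k  = live m<k
    ... | inj₂ refl = ¬dead

    search : ∀ fuel k → k + fuel ≡ length L → LiveUpTo k → ∃ λ n → T (dead (α (walk n))) × LiveUpTo n
    search zero       k k≡|L| live =
      ⊥-elim (ℕₚ.<-irrefl (trans (sym (ℕₚ.+-identityʳ k)) k≡|L|) (live-bounded live))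
    search (suc fuel) k k+fuel≡|L| live with T? (dead (α (walk k)))
    ... | yes dead-end = k , dead-end , live
    ... | no  ¬dead    = search fuel (suc k) (trans (sym (ℕₚ.+-suc k fuel)) k+fuel≡|L|) (extend live ¬dead)

    first-exit : ∃ λ n → T (dead (α (walk n))) × LiveUpTo n
    first-exit = search (length L) 0 refl (λ ())

    last : ℕ
    last = proj₁ first-exit

    live : LiveUpTo last
    live = proj₂ (proj₂ first-exit)

  end : A
  end = α (walk last)

  end-dead : T (dead end)
  end-dead = proj₁ (proj₂ first-exit)

  private
    colour-walk : ∀ {j} → j ≤ last → colour (walk j) ≡ colour z
    colour-walk {zero}  _       = refl
    colour-walk {suc j} j<last = begin
      colour (β (α (walk j)))   ≡⟨ colour-β (live j<last) ⟩
      not (colour (α (walk j))) ≡⟨ cong not (colour-α (walk j)) ⟩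
      not (not (colour (walk j))) ≡⟨ not-involutive _ ⟩
      colour (walk j)           ≡⟨ colour-walk (ℕₚ.<⇒≤ j<last) ⟩
      colour z                  ∎
      where open ≡-Reasoning

    OnPath : A → Set
    OnPath t = ∃ λ j → j ≤ last × (t ≡ walk j ⊎ t ≡ α (walk j))

    onPath-α : ∀ {t} → OnPath t → OnPath (α t)
    onPath-α (j , j≤ , inj₁ refl) = j , j≤ , inj₂ refl
    onPath-α (j , j≤ , inj₂ refl) = j , j≤ , inj₁ (α-invol (walk j))

    onPath-β : ∀ {t} → OnPath t → OnPath (β t)
    onPath-β (zero  , j≤ , inj₁ refl) = zero , j≤ , inj₁ (β-dead z-dead)
    onPath-β (suc j , j< , inj₁ refl) = j , ℕₚ.<⇒≤ j< , inj₂ (β-invol (α (walk j)))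
    onPath-β (j     , j≤ , inj₂ refl) with ℕₚ.m≤n⇒m<n∨m≡n j≤
    ... | inj₁ j<last = suc j , j<last , inj₁ refl
    ... | inj₂ refl   = j , j≤ , inj₂ (β-dead end-dead)

    onPath-closed : ∀ {x t} → Reach (α ∷ β ∷ []) x t → OnPath x → OnPath t
    onPath-closed ε                         p = p
    onPath-closed (here refl ◅ w)           p = onPath-closed w (onPath-α p)
    onPath-closed (there (here refl) ◅ w)   p = onPath-closed w (onPath-β p)
    onPath-closed (there (there ()) ◅ _)    _

    reach-walk : ∀ j → Reach (α ∷ β ∷ []) z (walk j)
    reach-walk zero    = ε
    reach-walk (suc j) = reach-walk j ◅◅ here refl ◅ there (here refl) ◅ ε

  reach-end : Reach (α ∷ β ∷ []) z end
  reach-end = reach-walk last ◅◅ here refl ◅ ε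

  end-colour : colour end ≡ not (colour z)
  end-colour = trans (colour-α (walk last)) (cong not (colour-walk ℕₚ.≤-refl))

  reachable-dead : ∀ {t} → Reach (α ∷ β ∷ []) z t → T (dead t) → t ≡ z ⊎ colour t ≡ not (colour z)
  reachable-dead w t-dead with onPath-closed w (zero , z≤n , inj₁ refl)
  ... | zero  , _ , inj₁ refl = inj₁ refl
  ... | suc j , j< , inj₁ refl = ⊥-elim (walk-live live j< t-dead)
  ... | j     , j≤ , inj₂ refl = inj₂ (trans (colour-α (walk j)) (cong not (colour-walk j≤)))

-- Orbits on flags

module _ {e : ℕ} where

  ∈-allFlags : (x : Flag e) → x ∈ allFlags e
  ∈-allFlags (i , a , b) = ∈-concatMap⁺ _ (Any.map (λ { refl → ∈-corners a b }) (∈-allFin i))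
    where
    ∈-corners : ∀ a b → (i , a , b) ∈ map (i ,_) ((false , false) ∷ (false , true) ∷ (true , false) ∷ (true , true) ∷ [])
    ∈-corners false false = here refl
    ∈-corners false true  = there (here refl)
    ∈-corners true  false = there (there (here refl))
    ∈-corners true  true  = there (there (there (here refl)))

  length-allFlags : length (allFlags e) ≡ 4 ℕ.* e
  length-allFlags = trans (length-concatMap (allFin e)) (cong (4 ℕ.*_) (length-tabulate {n = e} (λ i → i)))
    where
    length-concatMap : ∀ (is : List (Fin e)) →
      length (concatMap (λ i → map (i ,_) ((false , false) ∷ (false , true) ∷ (true , false) ∷ (true , true) ∷ [])) is)
      ≡ 4 ℕ.* length is
    length-concatMap []       = refl
    length-concatMap (i ∷ is) = trans (cong (λ n → 4 + n) (length-concatMap is)) (sym (ℕₚ.*-suc 4 (length is)))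

  module _ {gs : List (Flag e → Flag e)} where

    reachIn-sound : ∀ k {x y} → T (reachIn k gs x y) → Reach gs x y
    reachIn-sound zero          x≡y = subst (Reach gs _) (toWitness x≡y) ε
    reachIn-sound (suc k) {x} {y} h with Equivalence.to (T-∨ {⌊ x ≟F y ⌋}) h
    ... | inj₁ x≡y = subst (Reach gs x) (toWitness x≡y) ε
    ... | inj₂ h′ with find (any⁻ _ gs h′)
    ...   | g , g∈gs , gx↝y = step-∈ g∈gs x ◅ reachIn-sound k gx↝y

    reachIn-complete : ∀ k {x y} (w : Reach gs x y) → length (vertices w) ≤ suc k → T (reachIn k gs x y)
    reachIn-complete zero    ε       _       = fromWitness refl
    reachIn-complete zero    (_ ◅ ε) (s≤s ())
    reachIn-complete zero    (_ ◅ _ ◅ _) (s≤s ())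
    reachIn-complete (suc k) {x} {y} ε _ = T-∨-intro (⌊ x ≟F y ⌋) _ (inj₁ (fromWitness refl))
    reachIn-complete (suc k) {x} {y} (s ◅ w) (s≤s |w|≤k) =
      T-∨-intro (⌊ x ≟F y ⌋) _
        (inj₂ (any⁺ _ (Any.map (λ { refl → reachIn-complete k w |w|≤k }) s)))

    reach-sound : ∀ {x y} → Holds (reach gs) x y → Reach gs x y
    reach-sound = reachIn-sound (4 ℕ.* e)

    reach-complete : ∀ {x y} → Reach gs x y → Holds (reach gs) x y
    reach-complete w with erase-loops _≟F_ w
    ... | w′ , w′-unique = reachIn-complete (4 ℕ.* e) w′
      (ℕₚ.m≤n⇒m≤1+n (subst (length (vertices w′) ≤_) length-allFlags
        (Unique-length-≤ w′-unique (λ {z} _ → ∈-allFlags z))))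

    reach-isEquivalence : Involutions gs → IsEquivalence (Holds (reach gs))
    reach-isEquivalence invols = record
      { refl  = reach-complete ε
      ; sym   = reach-complete ∘ reach-sym invols ∘ reach-sound
      ; trans = λ h h′ → reach-complete (reach-sound h ◅◅ reach-sound h′)
      }

    reach-least : ∀ {r} → IsEquivalence (Holds r) → Step gs ⇒ Holds r → Holds (reach gs) ⇒ Holds r
    reach-least {r} r-equiv step⇒r =
      fold (Holds r) (λ s h → IsEquivalence.trans r-equiv (step⇒r s) h) (IsEquivalence.refl r-equiv) ∘ reach-sound

  orbits-countFresh : ∀ gs → orbits gs ≡ countFresh (reach gs) [] (allFlags e)
  orbits-countFresh gs = go [] (allFlags e)
    where
    go : ∀ seen xs → countReps gs seen xs ≡ countFresh (reach gs) seen xs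
    go seen []       = refl
    go seen (x ∷ xs) rewrite go (x ∷ seen) xs = refl

  orbits-cong : ∀ {gs gs′} → Step gs ⇒ Reach gs′ → Step gs′ ⇒ Reach gs → orbits gs ≡ orbits gs′
  orbits-cong {gs} {gs′} gs⇒gs′ gs′⇒gs = begin
    orbits gs                                  ≡⟨ orbits-countFresh gs ⟩
    countFresh (reach gs) [] (allFlags e)      ≡⟨ countFresh-cong (simulate gs⇒gs′) (simulate gs′⇒gs) [] (allFlags e) ⟩
    countFresh (reach gs′) [] (allFlags e)     ≡⟨ orbits-countFresh gs′ ⟨
    orbits gs′                                 ∎
    where
    open ≡-Reasoning
    simulate : ∀ {hs hs′} → Step hs ⇒ Reach hs′ → Holds (reach hs) ⇒ Holds (reach hs′)
    simulate hs⇒hs′ = reach-complete ∘ (hs⇒hs′ ⋆) ∘ reach-sound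

-- Penrose states

module _ {e : ℕ} where

  pairing-invol : (s : PenroseState e) → ∀ x → pairing s (pairing s x) ≡ x
  pairing-invol s (i , a , b) with s i in sᵢ
  ... | true  rewrite sᵢ = cong₂ (λ a b → i , a , b) (not-involutive a) (not-involutive b)
  ... | false rewrite sᵢ = cong (λ a → i , a , b) (not-involutive a)

  pairing-edge : (s : PenroseState e) → ∀ x → proj₁ (pairing s x) ≡ proj₁ x
  pairing-edge s (i , a , b) with s i
  ... | true  = refl
  ... | false = refl

  pairing-cong : ∀ {s σ : PenroseState e} x → s (proj₁ x) ≡ σ (proj₁ x) → pairing s x ≡ pairing σ x
  pairing-cong (i , a , b) eq = cong (λ c → if c then (i , not a , not b) else (i , not a , b)) eq

countTrue-cong : ∀ e {s s′ : PenroseState e} → (∀ j → s j ≡ s′ j) → countTrue e s ≡ countTrue e s′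
countTrue-cong zero    _    = refl
countTrue-cong (suc e) s≗s′ =
  cong₂ _+_ (cong (λ b → if b then 1 else 0) (s≗s′ zero)) (countTrue-cong e (s≗s′ ∘ suc))

countTrue-flip : ∀ e {s s′ : PenroseState e} i → (∀ j → j ≢ i → s j ≡ s′ j) → s i ≡ false → s′ i ≡ true →
                 countTrue e s′ ≡ suc (countTrue e s)
countTrue-flip (suc e) zero    agree sᵢ s′ᵢ rewrite sᵢ | s′ᵢ =
  cong suc (countTrue-cong e (λ j → sym (agree (suc j) (λ ()))))
countTrue-flip (suc e) (suc i) agree sᵢ s′ᵢ =
  trans (cong₂ _+_ (cong (λ b → if b then 1 else 0) (sym (agree zero (λ ()))))
                   (countTrue-flip e i (λ j j≢i → agree (suc j) (j≢i ∘ suc-injective)) sᵢ s′ᵢ))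
        (ℕₚ.+-suc _ _)

countTrue-none : ∀ e → countTrue e (λ _ → false) ≡ 0
countTrue-none zero    = refl
countTrue-none (suc e) = countTrue-none e

module _ {A : Set} where

  constant-if-flip-invariant : ∀ e (V : PenroseState e → A) →
    (∀ {s s′} → (∀ j → s j ≡ s′ j) → V s ≡ V s′) →
    (∀ {s s′} i → (∀ j → j ≢ i → s j ≡ s′ j) → s i ≡ false → s′ i ≡ true → V s ≡ V s′) →
    ∀ s → V s ≡ V (λ _ → false)
  constant-if-flip-invariant zero    V V-cong V-flip s = V-cong (λ ())
  constant-if-flip-invariant (suc e) V V-cong V-flip s = begin
    V s                                   ≡⟨ clear-head ⟩
    V (false Vector.∷ Vector.tail s)      ≡⟨ constant-if-flip-invariant e (V ∘ (false Vector.∷_)) V₀-cong V₀-flip (Vector.tail s) ⟩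
    V (false Vector.∷ (λ _ → false))      ≡⟨ V-cong (λ { zero → refl ; (suc j) → refl }) ⟩
    V (λ _ → false)                       ∎
    where
    open ≡-Reasoning
    clear-head : V s ≡ V (false Vector.∷ Vector.tail s)
    clear-head with s zero in s₀
    ... | false = V-cong (λ { zero → s₀ ; (suc j) → refl })
    ... | true  = sym (V-flip zero (λ { zero 0≢0 → ⊥-elim (0≢0 refl) ; (suc j) _ → refl }) refl s₀)
    V₀-cong : ∀ {t t′} → (∀ j → t j ≡ t′ j) → V (false Vector.∷ t) ≡ V (false Vector.∷ t′)
    V₀-cong t≗t′ = V-cong (λ { zero → refl ; (suc j) → t≗t′ j })
    V₀-flip : ∀ {t t′} i → (∀ j → j ≢ i → t j ≡ t′ j) → t i ≡ false → t′ i ≡ true →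
              V (false Vector.∷ t) ≡ V (false Vector.∷ t′)
    V₀-flip i agree = V-flip (suc i) (λ { zero _ → refl ; (suc j) j≢i → agree j (j≢i ∘ cong suc) })

sumStates-cong : ∀ e {f g : PenroseState e → ℤ} → (∀ s → f s ≡ g s) → sumStates e f ≡ sumStates e g
sumStates-cong zero    f≗g = f≗g _
sumStates-cong (suc e) f≗g = cong₂ ℤ._+_ (sumStates-cong e (λ _ → f≗g _)) (sumStates-cong e (λ _ → f≗g _))

sumStates-const : ∀ e (c : ℤ) → sumStates e (λ _ → c) ≡ c * + (2 ^ℕ e)
sumStates-const zero    c = sym (ℤₚ.*-identityʳ c)
sumStates-const (suc e) c = begin
  sumStates e (λ _ → c) ℤ.+ sumStates e (λ _ → c)   ≡⟨ cong₂ ℤ._+_ (sumStates-const e c) (sumStates-const e c) ⟩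
  c * + (2 ^ℕ e) ℤ.+ c * + (2 ^ℕ e)                 ≡⟨ ℤₚ.*-distribˡ-+ c (+ (2 ^ℕ e)) (+ (2 ^ℕ e)) ⟨
  c * (+ (2 ^ℕ e) ℤ.+ + (2 ^ℕ e))                   ≡⟨ cong (c *_) (ℤₚ.pos-+ (2 ^ℕ e) (2 ^ℕ e)) ⟨
  c * + (2 ^ℕ e + 2 ^ℕ e)                           ≡⟨ cong (λ n → c * + (2 ^ℕ e + n)) (ℕₚ.+-identityʳ (2 ^ℕ e)) ⟨
  c * + (2 ^ℕ suc e)                                ∎
  where open ≡-Reasoning

-- Medial curves

module _ (G : EmbeddedGraph) where

  curveOrbits : PenroseState (nEdges G) → ℕ
  curveOrbits s = orbits (τ₁ G ∷ pairing s ∷ [])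

  curve-involutions : ∀ s → Involutions (τ₁ G ∷ pairing s ∷ [])
  curve-involutions s = τ₁-invol G ∷ pairing-invol s ∷ []

  curveOrbits-cong : ∀ {s σ} → (∀ j → s j ≡ σ j) → curveOrbits s ≡ curveOrbits σ
  curveOrbits-cong s≗σ = orbits-cong (simulate s≗σ) (simulate (sym ∘ s≗σ))
    where
    simulate : ∀ {t t′} → (∀ j → t j ≡ t′ j) → Step (τ₁ G ∷ pairing t ∷ []) ⇒ Reach (τ₁ G ∷ pairing t′ ∷ [])
    simulate t≗t′                 (here refl)         = here refl ◅ ε
    simulate {t} {t′} t≗t′ {x} (there (here refl)) =
      there (here (sym (pairing-cong {s = t} {t′} x (t≗t′ (proj₁ x))))) ◅ ε

  faces-as-curves : orbits (τ₀ ∷ τ₁ G ∷ []) ≡ curveOrbits (λ _ → false)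
  faces-as-curves = orbits-cong faces⇒curves curves⇒faces
    where
    white-split : ∀ x → pairing (λ _ → false) x ≡ τ₀ x
    white-split (i , a , b) = refl
    faces⇒curves : Step (τ₀ ∷ τ₁ G ∷ []) ⇒ Reach (τ₁ G ∷ pairing (λ _ → false) ∷ [])
    faces⇒curves {x} (here refl)         = there (here (white-split x)) ◅ ε
    faces⇒curves     (there (here refl)) = here refl ◅ ε
    curves⇒faces : Step (τ₁ G ∷ pairing (λ _ → false) ∷ []) ⇒ Reach (τ₀ ∷ τ₁ G ∷ [])
    curves⇒faces     (here refl)         = there (here refl) ◅ ε
    curves⇒faces {x} (there (here refl)) = here (sym (white-split x)) ◅ ε

module _ (G : EmbeddedGraph) (ori : Orientable G) (chk : CheckerboardColourable G) where

  private
    e = nEdges G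
    o = proj₁ ori
    c = proj₁ chk

  -- o flips along τ₀, τ₁, τ₂ and c only along τ₂.
  curveColour : Flag e → Bool
  curveColour x = o x xor c x

  private
    flips : ∀ {x y} → o y ≢ o x → c y ≡ c x → curveColour y ≡ not (curveColour x)
    flips {x} o≢ c≡ = trans (cong₂ _xor_ (¬-not o≢) c≡) (sym (not-distribˡ-xor (o x) (c x)))

  curveColour-τ₀ : ∀ x → curveColour (τ₀ x) ≡ not (curveColour x)
  curveColour-τ₀ x = flips (proj₁ (proj₂ ori x)) (proj₁ (proj₂ chk x))

  curveColour-τ₁ : ∀ x → curveColour (τ₁ G x) ≡ not (curveColour x)
  curveColour-τ₁ x = flips (proj₁ (proj₂ (proj₂ ori x))) (proj₁ (proj₂ (proj₂ chk x)))

  curveColour-τ₂ : ∀ x → curveColour (τ₂ x) ≡ curveColour x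
  curveColour-τ₂ x = trans (cong₂ _xor_ (¬-not (proj₂ (proj₂ (proj₂ ori x)))) (¬-not (proj₂ (proj₂ (proj₂ chk x)))))
                           (xor-annihilates-not (o x) (c x))

  curveColour-pairing : ∀ s x → curveColour (pairing s x) ≡ not (curveColour x)
  curveColour-pairing s x@(i , a , b) with s i
  ... | true  = trans (curveColour-τ₀ (τ₂ x)) (cong not (curveColour-τ₂ x))
  ... | false = curveColour-τ₀ x

  module Cut (s : PenroseState e) (i : Fin e) where

    atEdge : Flag e → Bool
    atEdge x = ⌊ proj₁ x Fin.≟ i ⌋

    cut : Flag e → Flag e
    cut x = if atEdge x then x else pairing s x

    cutReach : Flag e → Flag e → Bool
    cutReach = reach (τ₁ G ∷ cut ∷ [])

    AgreeOff : PenroseState e → Set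
    AgreeOff σ = ∀ j → j ≢ i → s j ≡ σ j

    p q : Flag e
    p = i , false , false
    q = i , false , true

    glued : Bool → Flag e → Flag e → Bool
    glued b = merge (merge cutReach p (i , true , b)) q (i , true , not b)

    private
      cut-at : ∀ {x} → T (atEdge x) → cut x ≡ x
      cut-at {x} at with atEdge x
      ... | true  = refl

      cut-off : ∀ {x} → ¬ T (atEdge x) → cut x ≡ pairing s x
      cut-off {x} ¬at with atEdge x
      ... | true  = ⊥-elim (¬at tt)
      ... | false = refl

      atEdge-pairing : ∀ σ x → atEdge (pairing σ x) ≡ atEdge x
      atEdge-pairing σ x = cong (λ j → ⌊ j Fin.≟ i ⌋) (pairing-edge σ x)

      off-pairing : ∀ {x} → ¬ T (atEdge x) → ¬ T (atEdge (pairing s x))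
      off-pairing {x} = subst (λ b → ¬ T b) (sym (atEdge-pairing s x))

      cut-live : ∀ {x} → ¬ T (atEdge x) → ¬ T (atEdge (cut x))
      cut-live ¬at = subst (λ y → ¬ T (atEdge y)) (sym (cut-off ¬at)) (off-pairing ¬at)

      cut-invol : ∀ x → cut (cut x) ≡ x
      cut-invol x with T? (atEdge x)
      ... | yes at = trans (cong cut (cut-at at)) (cut-at at)
      ... | no ¬at = begin
        cut (cut x)             ≡⟨ cong cut (cut-off ¬at) ⟩
        cut (pairing s x)       ≡⟨ cut-off (off-pairing ¬at) ⟩
        pairing s (pairing s x) ≡⟨ pairing-invol s x ⟩
        x                       ∎
        where open ≡-Reasoning

      cut-colour : ∀ {x} → ¬ T (atEdge x) → curveColour (cut x) ≡ not (curveColour x)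
      cut-colour {x} ¬at = trans (cong curveColour (cut-off ¬at)) (curveColour-pairing s x)

      cut-equiv : IsEquivalence (Holds cutReach)
      cut-equiv = reach-isEquivalence (τ₁-invol G ∷ cut-invol ∷ [])

      module C = IsEquivalence cut-equiv

      at-i : ∀ a b → T (atEdge (i , a , b))
      at-i a b = fromWitness refl

      module FromDeadEnd (z : Flag e) (z-at : T (atEdge z)) =
        DeadEndPath (allFlags e) ∈-allFlags (τ₁ G) cut (τ₁-invol G) cut-invol
                    atEdge cut-at cut-live curveColour curveColour-τ₁ cut-colour z z-at

      colour-q : curveColour q ≡ curveColour p
      colour-q = curveColour-τ₂ p

      far-end : ∀ {t} → T (atEdge t) → curveColour t ≡ not (curveColour p) → t ≡ (i , true , false) ⊎ t ≡ (i , true , true)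
      far-end {j , a , b} at colour with toWitness at
      far-end {_ , false , false} _ colour | refl = ⊥-elim (not-¬ refl colour)
      far-end {_ , false , true}  _ colour | refl = ⊥-elim (not-¬ refl (trans (sym colour-q) colour))
      far-end {_ , true  , false} _ _      | refl = inj₁ refl
      far-end {_ , true  , true}  _ _      | refl = inj₂ refl

      reaches-far-end : ∀ {z} → T (atEdge z) → curveColour z ≡ curveColour p →
                        Holds cutReach z (i , true , false) ⊎ Holds cutReach z (i , true , true)
      reaches-far-end {z} z-at colour
        with far-end (FromDeadEnd.end-dead z z-at) (trans (FromDeadEnd.end-colour z z-at) (cong not colour))
      ... | inj₁ end≡ = inj₁ (subst (Holds cutReach z) end≡ (reach-complete (FromDeadEnd.reach-end z z-at)))
      ... | inj₂ end≡ = inj₂ (subst (Holds cutReach z) end≡ (reach-complete (FromDeadEnd.reach-end z z-at)))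

      p≁q : ¬ Holds cutReach p q
      p≁q p~q with FromDeadEnd.reachable-dead p (at-i false false) (reach-sound p~q) (at-i false true)
      ... | inj₂ colour = not-¬ refl (trans (sym colour-q) colour)

      glued-equiv : ∀ b → IsEquivalence (Holds (glued b))
      glued-equiv b = merge-isEquivalence (merge-isEquivalence cut-equiv p _) q _

      first-pair : ∀ b → Holds (glued b) p (i , true , b)
      first-pair b = ⊆-merge (merge cutReach p (i , true , b)) q (i , true , not b) (merge-relates cut-equiv p _)

      second-pair : ∀ b → Holds (glued b) q (i , true , not b)
      second-pair b = merge-relates (merge-isEquivalence cut-equiv p _) q _

      at-edge-pairs : ∀ b a c → Holds (glued b) (i , a , c) (if b then (i , not a , not c) else (i , not a , c))
      at-edge-pairs false false false = first-pair false
      at-edge-pairs false false true  = second-pair false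
      at-edge-pairs false true  false = IsEquivalence.sym (glued-equiv false) (first-pair false)
      at-edge-pairs false true  true  = IsEquivalence.sym (glued-equiv false) (second-pair false)
      at-edge-pairs true  false false = first-pair true
      at-edge-pairs true  false true  = second-pair true
      at-edge-pairs true  true  false = IsEquivalence.sym (glued-equiv true) (second-pair true)
      at-edge-pairs true  true  true  = IsEquivalence.sym (glued-equiv true) (first-pair true)

    module _ {σ : PenroseState e} (agree : AgreeOff σ) where

      private
        curve-equiv : IsEquivalence (Holds (reach (τ₁ G ∷ pairing σ ∷ [])))
        curve-equiv = reach-isEquivalence (curve-involutions G σ)

        pairing-off : ∀ {x} → ¬ T (atEdge x) → pairing σ x ≡ cut x
        pairing-off {x} ¬at =
          trans (sym (pairing-cong {s = s} {σ} x (agree (proj₁ x) (¬at ∘ fromWitness)))) (sym (cut-off ¬at))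

        curves⇒glued : Holds (reach (τ₁ G ∷ pairing σ ∷ [])) ⇒ Holds (glued (σ i))
        curves⇒glued = reach-least (glued-equiv (σ i)) step⇒glued
          where
          cut-step : ∀ {x y} → Step (τ₁ G ∷ cut ∷ []) x y → Holds (glued (σ i)) x y
          cut-step s = ⊆-merge (merge cutReach p (i , true , σ i)) q (i , true , not (σ i))
                              (⊆-merge cutReach p (i , true , σ i) (reach-complete (s ◅ ε)))
          step⇒glued : Step (τ₁ G ∷ pairing σ ∷ []) ⇒ Holds (glued (σ i))
          step⇒glued (here refl) = cut-step (here refl)
          step⇒glued {x} (there (here refl)) with T? (atEdge x)
          ... | no ¬at = cut-step (there (here (sym (pairing-off ¬at))))
          step⇒glued {j , a , c} (there (here refl)) | yes at with toWitness at
          ... | refl = at-edge-pairs (σ i) a c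

        glued⇒curves : Holds (glued (σ i)) ⇒ Holds (reach (τ₁ G ∷ pairing σ ∷ []))
        glued⇒curves = merge-least curve-equiv (merge-least curve-equiv cut⇒curves (pairing-step p p↦))
                                   (pairing-step q q↦)
          where
          p↦ : pairing σ p ≡ (i , true , σ i)
          p↦ with σ i
          ... | true  = refl
          ... | false = refl
          q↦ : pairing σ q ≡ (i , true , not (σ i))
          q↦ with σ i
          ... | true  = refl
          ... | false = refl
          pairing-step : ∀ x {y} → pairing σ x ≡ y → Holds (reach (τ₁ G ∷ pairing σ ∷ [])) x y
          pairing-step x x↦y = reach-complete (there (here x↦y) ◅ ε)
          cut⇒pairing : Step (τ₁ G ∷ cut ∷ []) ⇒ Reach (τ₁ G ∷ pairing σ ∷ [])
          cut⇒pairing (here refl) = here refl ◅ ε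
          cut⇒pairing {x} (there (here refl)) with T? (atEdge x)
          ... | yes at = subst (Reach _ x) (sym (cut-at at)) ε
          ... | no ¬at = there (here (pairing-off ¬at)) ◅ ε
          cut⇒curves : Holds cutReach ⇒ Holds (reach (τ₁ G ∷ pairing σ ∷ []))
          cut⇒curves = reach-complete ∘ (cut⇒pairing ⋆) ∘ reach-sound

      curveOrbits-glued : curveOrbits G σ ≡ countFresh (glued (σ i)) [] (allFlags e)
      curveOrbits-glued = trans (orbits-countFresh (τ₁ G ∷ pairing σ ∷ [])) (countFresh-cong curves⇒glued glued⇒curves [] (allFlags e))

    curveOrbits-flip : ∀ {s′} → AgreeOff s′ → s i ≡ false → s′ i ≡ true →
                       curveOrbits G s ≡ suc (curveOrbits G s′) ⊎ curveOrbits G s′ ≡ suc (curveOrbits G s)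
    curveOrbits-flip {s′} agree sᵢ s′ᵢ
      rewrite curveOrbits-glued {s} (λ _ _ → refl) | curveOrbits-glued agree | sᵢ | s′ᵢ
      with T? (cutReach p (i , true , false))
    ... | yes pP with reaches-far-end (at-i false true) colour-q
    ...   | inj₁ qP = ⊥-elim (p≁q (C.trans pP (C.sym qP)))
    ...   | inj₂ qQ = inj₁ (countFresh-reconnect cut-equiv p≁q pP qQ (∈-allFlags p) (∈-allFlags _))
    curveOrbits-flip agree sᵢ s′ᵢ | no ¬pP
      with reaches-far-end (at-i false false) refl | reaches-far-end (at-i false true) colour-q
    ... | inj₁ pP | _       = ⊥-elim (¬pP pP)
    ... | inj₂ pQ | inj₁ qP = inj₂ (countFresh-reconnect cut-equiv p≁q pQ qP (∈-allFlags p) (∈-allFlags _))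
    ... | inj₂ pQ | inj₂ qQ = ⊥-elim (p≁q (C.trans pQ (C.sym qQ)))

  sign : PenroseState e → ℤ
  sign s = -1ℤ ^ (cr s + curves G s)

  private
    -1^-suc-suc : ∀ n → -1ℤ ^ suc (suc n) ≡ -1ℤ ^ n
    -1^-suc-suc n = trans (ℤₚ.^-distribˡ-+-* -1ℤ 2 n) (ℤₚ.*-identityˡ (-1ℤ ^ n))

    sign-cong : ∀ {s s′} → (∀ j → s j ≡ s′ j) → sign s ≡ sign s′
    sign-cong s≗s′ =
      cong (-1ℤ ^_) (cong₂ _+_ (countTrue-cong e s≗s′) (cong (_+ nIsolated G) (curveOrbits-cong G s≗s′)))

    sign-flip : ∀ {s s′} i → (∀ j → j ≢ i → s j ≡ s′ j) → s i ≡ false → s′ i ≡ true → sign s ≡ sign s′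
    sign-flip {s} {s′} i agree sᵢ s′ᵢ with Cut.curveOrbits-flip s i agree sᵢ s′ᵢ
    ... | inj₁ fewer = cong (-1ℤ ^_) (begin
      cr s + (curveOrbits G s + nIsolated G)         ≡⟨ cong (λ n → cr s + (n + nIsolated G)) fewer ⟩
      cr s + suc (curveOrbits G s′ + nIsolated G)    ≡⟨ ℕₚ.+-suc (cr s) _ ⟩
      suc (cr s) + (curveOrbits G s′ + nIsolated G)  ≡⟨ cong (_+ (curveOrbits G s′ + nIsolated G)) (countTrue-flip e i agree sᵢ s′ᵢ) ⟨
      cr s′ + (curveOrbits G s′ + nIsolated G)       ∎)
      where open ≡-Reasoning
    ... | inj₂ more = sym (trans (cong (-1ℤ ^_) (begin
      cr s′ + (curveOrbits G s′ + nIsolated G)       ≡⟨ cong₂ (λ m n → m + (n + nIsolated G)) (countTrue-flip e i agree sᵢ s′ᵢ) more ⟩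
      suc (cr s + suc (curveOrbits G s + nIsolated G)) ≡⟨ cong suc (ℕₚ.+-suc (cr s) _) ⟩
      suc (suc (cr s + (curveOrbits G s + nIsolated G))) ∎)) (-1^-suc-suc (cr s + (curveOrbits G s + nIsolated G))))
      where open ≡-Reasoning

  sign-constant : ∀ s → sign s ≡ sign (λ _ → false)
  sign-constant = constant-if-flip-invariant e sign sign-cong sign-flip

proposition6p4 : (G : EmbeddedGraph) → Orientable G → CheckerboardColourable G →
                 P G -1ℤ ≡ (-1ℤ ^ f[ G ]) * (+ (2 ^ℕ e[ G ]))
proposition6p4 G ori chk = trans (sumStates-cong e each-state) (sumStates-const e (-1ℤ ^ f[ G ]))
  where
  e = nEdges G
  each-state : ∀ s → (-1ℤ ^ cr s) * (-1ℤ ^ curves G s) ≡ -1ℤ ^ f[ G ]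
  each-state s = begin
    (-1ℤ ^ cr s) * (-1ℤ ^ curves G s)        ≡⟨ ℤₚ.^-distribˡ-+-* -1ℤ (cr s) (curves G s) ⟨
    sign G ori chk s                         ≡⟨ sign-constant G ori chk s ⟩
    sign G ori chk (λ _ → false)             ≡⟨ cong (λ n → -1ℤ ^ (n + curves G (λ _ → false))) (countTrue-none e) ⟩
    -1ℤ ^ curves G (λ _ → false)             ≡⟨ cong (λ n → -1ℤ ^ (n + nIsolated G)) (faces-as-curves G) ⟨
    -1ℤ ^ f[ G ]                             ∎
    where open ≡-Reasoning
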